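{- Every $3$-colourable $(P_5,\overline{P_5},C_5)$-free graph is compact.
   Context: All graphs are finite and simple. $P_5$ is the path on $5$ vertices, $\overline{P_5}$ its complement, $C_5$ the $5$-cycle; a graph is $(P_5,\overline{P_5},C_5)$-free if it contains none of them as an induced subgraph. A hole is an induced cycle of length at least $5$; an antihole is an induced subgraph whose complement is a hole. A graph is weakly chordal if it has no hole and no antihole. $N_H(u)$ denotes the neighbourhood of $u$ in $H$. A 2-pair of a graph $H$ is a pair $\{x,y\}$ of distinct nonadjacent vertices such that every chordless path from $x$ to $y$ has length $2$. For a 2-pair $\{x,y\}$ of $H$, $S(x,y)=N_H(x)\cap N_H(y)$ and $C_x$ is the component of $H-S(x,y)$ containing $x$. A weakly chordal graph $G$ is compact if every subgraph $H$ of $G$ either (i) is complete, or (ii) contains a 2-pair $\{x,y\}$ with $N_H(x)\subseteq N_H(y)$, or (iii) contains a 2-pair $\{x,y\}$ such that $C_x\cup S(x,y)$ induces a clique on at most three vertices. -}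

module Defs where

open import Data.Nat using (ℕ; _≤_)
open import Data.Nat using () renaming (suc to sucℕ)
open import Data.Fin using (Fin; toℕ; fromℕ; zero; suc)
open import Data.Fin.Subset using (Subset; _∈_; _∉_)
open import Data.Bool using (Bool; true; false)
open import Data.Product using (Σ; _×_; _,_; ∃)
open import Data.Sum using (_⊎_)
open import Relation.Nullary using (¬_)
open import Relation.Binary.PropositionalEquality using (_≡_; _≢_)
open import Function.Definitions using (Injective)
open import Function.Bundles using (_⇔_)

record Graph (n : ℕ) : Set where
  field
    adj    : Fin n → Fin n → Bool
    sym    : ∀ i j → adj i j ≡ adj j i
    irrefl : ∀ i → adj i i ≡ false

module _ {n : ℕ} (G : Graph n) where
  open Graph G

  Edge : Fin n → Fin n → Set
  Edge i j = adj i j ≡ true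

  InducedIn : {k : ℕ} → Subset n → (Fin k → Fin k → Set) → (Fin k → Fin n) → Set
  InducedIn H R f =
    (∀ i → f i ∈ H) × Injective _≡_ _≡_ f × (∀ i j → (Edge (f i) (f j) ⇔ R i j))

  ContainsInduced : {k : ℕ} → (Fin k → Fin k → Set) → Set
  ContainsInduced {k} R = Σ (Fin k → Fin n) λ f →
    (∀ i j → (Edge (f i) (f j) ⇔ R i j)) × Injective _≡_ _≡_ f

PathAdj : (k : ℕ) → Fin k → Fin k → Set
PathAdj k i j = (sucℕ (toℕ i) ≡ toℕ j) ⊎ (sucℕ (toℕ j) ≡ toℕ i)

CycleAdj : (k : ℕ) → Fin k → Fin k → Set
CycleAdj k i j = PathAdj k i j
  ⊎ ((toℕ i ≡ 0 × sucℕ (toℕ j) ≡ k) ⊎ (toℕ j ≡ 0 × sucℕ (toℕ i) ≡ k))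

Complement : (k : ℕ) → (Fin k → Fin k → Set) → Fin k → Fin k → Set
Complement k R i j = (i ≢ j) × ¬ R i j

P5 : Fin 5 → Fin 5 → Set
P5 = PathAdj 5

coP5 : Fin 5 → Fin 5 → Set
coP5 = Complement 5 (PathAdj 5)

C5 : Fin 5 → Fin 5 → Set
C5 = CycleAdj 5

module _ {n : ℕ} (G : Graph n) where

  P5-coP5-C5-free : Set
  P5-coP5-C5-free =
    ¬ ContainsInduced G P5 × ¬ ContainsInduced G coP5 × ¬ ContainsInduced G C5

  ThreeColourable : Set
  ThreeColourable = Σ (Fin n → Fin 3) λ c → ∀ i j → Edge G i j → c i ≢ c j

  WeaklyChordal : Set
  WeaklyChordal = ∀ k → 5 ≤ k →
    ¬ ContainsInduced G (CycleAdj k) × ¬ ContainsInduced G (Complement k (CycleAdj k))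

  module _ (H : Subset n) where

    Complete : Set
    Complete = ∀ u v → u ∈ H → v ∈ H → u ≢ v → Edge G u v

    ChordlessPath : Fin n → Fin n → (m : ℕ) → Set
    ChordlessPath x y m = Σ (Fin (sucℕ m) → Fin n) λ p →
      InducedIn G H (PathAdj (sucℕ m)) p × (p zero ≡ x) × (p (fromℕ m) ≡ y)

    TwoPair : Fin n → Fin n → Set
    TwoPair x y = x ∈ H × y ∈ H × x ≢ y × ¬ Edge G x y ×
      (∀ m → ChordlessPath x y m → m ≡ 2)

    NbhdIncl : Fin n → Fin n → Set
    NbhdIncl x y = ∀ z → z ∈ H → Edge G x z → Edge G y z

    InS : Fin n → Fin n → Fin n → Set
    InS x y z = z ∈ H × Edge G x z × Edge G y z

    InHminusS : Fin n → Fin n → Fin n → Set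
    InHminusS x y z = z ∈ H × ¬ InS x y z

    data Reach (Q : Fin n → Set) (a : Fin n) : Fin n → Set where
      here : Q a → Reach Q a a
      step : ∀ {u w} → Reach Q a u → Q w → Edge G u w → Reach Q a w

    InCx : Fin n → Fin n → Fin n → Set
    InCx x y z = Reach (InHminusS x y) x z

    SmallCliqueCond : Fin n → Fin n → Set
    SmallCliqueCond x y =
      (∀ u v → T u → T v → u ≢ v → Edge G u v) ×
      (∀ (f : Fin 4 → Fin n) → (∀ i → T (f i)) → ¬ Injective _≡_ _≡_ f)
      where
        T : Fin n → Set
        T z = InCx x y z ⊎ InS x y z

  Compact : Set
  Compact = WeaklyChordal ×
    (∀ (H : Subset n) →
       Complete H
       ⊎ (∃ λ x → ∃ λ y → TwoPair H x y × NbhdIncl H x y)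
       ⊎ (∃ λ x → ∃ λ y → TwoPair H x y × SmallCliqueCond H x y))

-- Weak chordality is immediate: holes and antiholes of length at least 6 contain P5 and its
-- complement, and the antihole of length 5 is C5 itself.
--
-- Let H be a non-complete subgraph. A nonadjacent pair x, y with N(x) ⊆ N(y) is a 2-pair, since
-- the second vertex of a longer chordless x-y path would be a neighbour of x but not of y.
-- Otherwise every vertex of a nonadjacent pair has a neighbour missed by the other. Together with
-- the absence of K4 (from 3-colourability), P5, C5 and the house this excludes induced diamonds
-- and C4s, so nonadjacent vertices have at most one common neighbour and no induced P4 a-b-c-d
-- extends at d by a vertex missing c. From this, for every induced P3 x-s-y one end, say x, is
-- simplicial and "confined": a neighbour of x outside N(y) has no neighbour outside N[x]. Then
-- {x, y} is a 2-pair and C_x ∪ S(x, y) lies in the clique N[x], which has at most 3 vertices.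

module Submission where

open import Defs
open import Data.Bool using (true; false)
import Data.Bool as Bool
open import Data.Empty using (⊥; ⊥-elim)
open import Data.Fin using (Fin; toℕ; fromℕ; inject≤)
open import Data.Fin.Patterns using (0F; 1F; 2F; 3F; 4F)
import Data.Fin.Properties as Fin
open import Data.Fin.Subset using (Subset; _∈_)
open import Data.Fin.Subset.Properties using (_∈?_)
open import Data.Nat using (ℕ; suc; _≤_; s≤s)
import Data.Nat.Properties as ℕ
open import Data.Product using (_×_; _,_; ∃; ∃₂; proj₁; proj₂)
open import Data.Sum using (_⊎_; inj₁; inj₂)
open import Data.Vec using (_∷_; []; lookup)
open import Function.Base using (id; case_of_)
open import Function.Bundles using (_⇔_; mk⇔; Equivalence)
open import Function.Construct.Composition using (_⇔-∘_)
open import Function.Definitions using (Injective)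
open import Relation.Binary using (Decidable)
open import Relation.Binary.PropositionalEquality using (_≡_; _≢_; refl; sym; trans; cong; cong₂; subst; ≢-sym)
open import Relation.Nullary using (¬_; Dec; yes; no; does)
open import Relation.Nullary.Decidable using (_⊎-dec_; _×-dec_; _→-dec_; ¬?; True; toWitness; from-yes; dec-true)

PathAdj? : ∀ k → Decidable (PathAdj k)
PathAdj? k i j = (suc (toℕ i) ℕ.≟ toℕ j) ⊎-dec (suc (toℕ j) ℕ.≟ toℕ i)

CycleAdj? : ∀ k → Decidable (CycleAdj k)
CycleAdj? k i j = PathAdj? k i j ⊎-dec
  (((toℕ i ℕ.≟ 0) ×-dec (suc (toℕ j) ℕ.≟ k)) ⊎-dec ((toℕ j ℕ.≟ 0) ×-dec (suc (toℕ i) ℕ.≟ k)))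

Complement? : ∀ k {R : Fin k → Fin k → Set} → Decidable R → Decidable (Complement k R)
Complement? k R? i j = ¬? (i Fin.≟ j) ×-dec ¬? (R? i j)

does⇒ : ∀ {A : Set} (a? : Dec A) → does a? ≡ true → A
does⇒ (yes a) _ = a

does-⇔ : ∀ {A B : Set} (a? : Dec A) (b? : Dec B) → does a? ≡ does b? → A ⇔ B
does-⇔ (yes a) (yes b) _ = mk⇔ (λ _ → b) (λ _ → a)
does-⇔ (no ¬a) (no ¬b) _ = mk⇔ (λ a → ⊥-elim (¬a a)) (λ b → ⊥-elim (¬b b))

module _ {k l : ℕ} {R : Fin k → Fin k → Set} {S : Fin l → Fin l → Set}
         (g : Fin k → Fin l) (g-injective : Injective _≡_ _≡_ g)
         (g-preserves : ∀ i j → S (g i) (g j) ⇔ R i j) where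

  Complement-preserved : ∀ i j → Complement l S (g i) (g j) ⇔ Complement k R i j
  Complement-preserved i j = mk⇔
    (λ (g≢ , ¬S) → (λ i≡j → g≢ (cong g i≡j)) , λ r → ¬S (Equivalence.from (g-preserves i j) r))
    (λ (i≢ , ¬R) → (λ g≡ → i≢ (g-injective g≡)) , λ s → ¬R (Equivalence.to (g-preserves i j) s))

  ContainsInduced-restrict : ∀ {n} (G : Graph n) → ContainsInduced G S → ContainsInduced G R
  ContainsInduced-restrict G (f , f-iso , f-injective) =
    (λ i → f (g i)) , (λ i j → g-preserves i j ⇔-∘ f-iso (g i) (g j)) , (λ eq → g-injective (f-injective eq))

module _ {k : ℕ} (6≤k : 6 ≤ k) where

  prefix : Fin 5 → Fin k
  prefix i = inject≤ i (ℕ.<⇒≤ 6≤k)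

  private
    toℕ-prefix : ∀ i → toℕ (prefix i) ≡ toℕ i
    toℕ-prefix i = Fin.toℕ-inject≤ i _

    no-wrap : ∀ j → suc (toℕ (prefix j)) ≢ k
    no-wrap j = ℕ.<⇒≢ (begin-strict
      suc (toℕ (prefix j)) ≡⟨ cong suc (toℕ-prefix j) ⟩
      suc (toℕ j)          <⟨ s≤s (Fin.toℕ<n j) ⟩
      6                    ≤⟨ 6≤k ⟩
      k                    ∎)
      where open ℕ.≤-Reasoning

  prefix-injective : Injective _≡_ _≡_ prefix
  prefix-injective = Fin.inject≤-injective _ _ _ _

  CycleAdj-prefix : ∀ i j → CycleAdj k (prefix i) (prefix j) ⇔ PathAdj 5 i j
  CycleAdj-prefix i j = mk⇔ to (λ p → inj₁ (subst id (sym same) p))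
    where
    same : PathAdj k (prefix i) (prefix j) ≡ PathAdj 5 i j
    same = cong₂ (λ a b → (suc a ≡ b) ⊎ (suc b ≡ a)) (toℕ-prefix i) (toℕ-prefix j)
    to : CycleAdj k (prefix i) (prefix j) → PathAdj 5 i j
    to (inj₁ p) = subst id same p
    to (inj₂ (inj₁ (_ , e))) = ⊥-elim (no-wrap j e)
    to (inj₂ (inj₂ (_ , e))) = ⊥-elim (no-wrap i e)

-- multiplication by 2 modulo 5
σ : Fin 5 → Fin 5
σ i = lookup (0F ∷ 2F ∷ 4F ∷ 1F ∷ 3F ∷ []) i

σ-injective : Injective _≡_ _≡_ σ
σ-injective {i} {j} = from-yes (Fin.all? λ i → Fin.all? λ j → (σ i Fin.≟ σ j) →-dec (i Fin.≟ j)) i j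

C5-self-complementary : ∀ i j → Complement 5 C5 (σ i) (σ j) ⇔ C5 i j
C5-self-complementary i j = does-⇔ (Complement? 5 (CycleAdj? 5) (σ i) (σ j)) (CycleAdj? 5 i j)
  (from-yes (Fin.all? λ i → Fin.all? λ j →
    does (Complement? 5 (CycleAdj? 5) (σ i) (σ j)) Bool.≟ does (CycleAdj? 5 i j)) i j)

record Pattern {k : ℕ} (R : Fin k → Fin k → Set) : Set where
  field
    decide      : Decidable R
    symmetric   : ∀ i j → does (decide i j) ≡ does (decide j i)
    irreflexive : ∀ i → does (decide i i) ≡ false
    -- distinct vertices are adjacent or told apart by a third, so every realisation is injective
    separating  : ∀ i j → i ≡ j ⊎ does (decide i j) ≡ true ⊎ ∃ λ l → does (decide i l) ≢ does (decide j l)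

module _ {k : ℕ} {R : Fin k → Fin k → Set} (R? : Decidable R) where

  symmetric? : Dec (∀ i j → does (R? i j) ≡ does (R? j i))
  symmetric? = Fin.all? λ i → Fin.all? λ j → does (R? i j) Bool.≟ does (R? j i)

  irreflexive? : Dec (∀ i → does (R? i i) ≡ false)
  irreflexive? = Fin.all? λ i → does (R? i i) Bool.≟ false

  separating? : Dec (∀ i j → i ≡ j ⊎ does (R? i j) ≡ true ⊎ ∃ λ l → does (R? i l) ≢ does (R? j l))
  separating? = Fin.all? λ i → Fin.all? λ j → (i Fin.≟ j) ⊎-dec
    ((does (R? i j) Bool.≟ true) ⊎-dec Fin.any? λ l → ¬? (does (R? i l) Bool.≟ does (R? j l)))

  mkPattern : True symmetric? → True irreflexive? → True separating? → Pattern R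
  mkPattern s i d = record { decide = R? ; symmetric = toWitness s ; irreflexive = toWitness i ; separating = toWitness d }

P5-pattern : Pattern P5
P5-pattern = mkPattern (PathAdj? 5) _ _ _

C5-pattern : Pattern C5
C5-pattern = mkPattern (CycleAdj? 5) _ _ _

coP5-pattern : Pattern coP5
coP5-pattern = mkPattern (Complement? 5 (PathAdj? 5)) _ _ _

weaklyChordal : ∀ {n} (G : Graph n) → P5-coP5-C5-free G → WeaklyChordal G
weaklyChordal G (noP5 , noCoP5 , noC5) k 5≤k with ℕ.m≤n⇒m<n∨m≡n 5≤k
... | inj₂ refl = noC5 , λ antihole → noC5 (ContainsInduced-restrict {S = Complement 5 C5} σ σ-injective C5-self-complementary G antihole)
... | inj₁ 6≤k =
  (λ hole → noP5 (ContainsInduced-restrict {S = CycleAdj _} (prefix 6≤k) (prefix-injective 6≤k) (CycleAdj-prefix 6≤k) G hole)) ,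
  (λ antihole → noCoP5 (ContainsInduced-restrict {S = Complement _ (CycleAdj _)} (prefix 6≤k) (prefix-injective 6≤k)
     (Complement-preserved {S = CycleAdj _} (prefix 6≤k) (prefix-injective 6≤k) (CycleAdj-prefix 6≤k)) G antihole))

search₂ : ∀ {n} {P : Fin n → Fin n → Set} → (∀ i j → Dec (P i j)) → ∃₂ P ⊎ (∀ i j → ¬ P i j)
search₂ P? with Fin.any? (λ i → Fin.any? (P? i))
... | yes (i , j , p) = inj₁ (i , j , p)
... | no none = inj₂ λ i j p → none (i , j , p)

module _ {n : ℕ} (G : Graph n) where
  open Graph G using (adj; irrefl) renaming (sym to adj-sym)

  infix 4 _~_ _≁_
  _~_ _≁_ : Fin n → Fin n → Set
  u ~ v = adj u v ≡ true
  u ≁ v = adj u v ≡ false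

  ~-sym : ∀ {u v} → u ~ v → v ~ u
  ~-sym {u} {v} e = trans (adj-sym v u) e

  ≁-sym : ∀ {u v} → u ≁ v → v ≁ u
  ≁-sym {u} {v} e = trans (adj-sym v u) e

  ~⇒≢ : ∀ {u v} → u ~ v → u ≢ v
  ~⇒≢ {u} e refl with () ← trans (sym e) (irrefl u)

  separated⇒≢ : ∀ {u v w} → u ~ w → v ≁ w → u ≢ v
  separated⇒≢ e f refl with () ← trans (sym e) f

  ≁⇒¬~ : ∀ {u v} → u ≁ v → ¬ u ~ v
  ≁⇒¬~ f e with () ← trans (sym e) f

  ~-or-≁ : ∀ u v → u ~ v ⊎ u ≁ v
  ~-or-≁ u v with adj u v
  ... | true  = inj₁ refl
  ... | false = inj₂ refl

  ¬~⇒≁ : ∀ {u v} → ¬ u ~ v → u ≁ v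
  ¬~⇒≁ {u} {v} ¬uv with ~-or-≁ u v
  ... | inj₁ uv = ⊥-elim (¬uv uv)
  ... | inj₂ uv = uv

  ¬≁⇒~ : ∀ {u v} → ¬ u ≁ v → u ~ v
  ¬≁⇒~ {u} {v} ¬uv with ~-or-≁ u v
  ... | inj₁ uv = uv
  ... | inj₂ uv = ⊥-elim (¬uv uv)

  induced-from-table : ∀ {k} {R : Fin k → Fin k → Set} (P : Pattern R) (f : Fin k → Fin n) →
    (∀ i j → adj (f i) (f j) ≡ does (Pattern.decide P i j)) → ContainsInduced G R
  induced-from-table P f table = f , (λ i j → mk⇔ (λ e → does⇒ (R? i j) (trans (sym (table i j)) e))
                                                  (λ r → trans (table i j) (dec-true (R? i j) r))) , injective
    where
    open Pattern P renaming (decide to R?)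
    injective : ∀ {i j} → f i ≡ f j → i ≡ j
    injective {i} {j} eq with separating i j
    ... | inj₁ i≡j = i≡j
    ... | inj₂ (inj₁ Rij) with () ← trans (sym Rij) (trans (sym (table i j)) (trans (cong (λ v → adj v (f j)) eq) (irrefl (f j))))
    ... | inj₂ (inj₂ (l , differ)) = ⊥-elim (differ (trans (sym (table i l)) (trans (cong (λ v → adj v (f l)) eq) (table j l))))

  table₅ : ∀ {R : Fin 5 → Fin 5 → Set} (P : Pattern R) → let M = λ i j → does (Pattern.decide P i j) in
    ∀ {a b c d e} →
    adj a b ≡ M 0F 1F → adj a c ≡ M 0F 2F → adj a d ≡ M 0F 3F → adj a e ≡ M 0F 4F →
    adj b c ≡ M 1F 2F → adj b d ≡ M 1F 3F → adj b e ≡ M 1F 4F →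
    adj c d ≡ M 2F 3F → adj c e ≡ M 2F 4F → adj d e ≡ M 3F 4F →
    let f = lookup (a ∷ b ∷ c ∷ d ∷ e ∷ []) in ∀ i j → adj (f i) (f j) ≡ M i j
  table₅ P {a} {b} {c} {d} {e} ab ac ad ae bc bd be cd ce de = table
    where
    open Pattern P
    f = lookup (a ∷ b ∷ c ∷ d ∷ e ∷ [])
    diagonal : ∀ i → adj (f i) (f i) ≡ does (decide i i)
    diagonal i = trans (irrefl (f i)) (sym (irreflexive i))
    transpose : ∀ {i j} → adj (f i) (f j) ≡ does (decide i j) → adj (f j) (f i) ≡ does (decide j i)
    transpose {i} {j} t = trans (adj-sym (f j) (f i)) (trans t (symmetric i j))
    table : ∀ i j → adj (f i) (f j) ≡ does (decide i j)
    table 0F 0F = diagonal 0F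
    table 0F 1F = ab
    table 0F 2F = ac
    table 0F 3F = ad
    table 0F 4F = ae
    table 1F 0F = transpose ab
    table 1F 1F = diagonal 1F
    table 1F 2F = bc
    table 1F 3F = bd
    table 1F 4F = be
    table 2F 0F = transpose ac
    table 2F 1F = transpose bc
    table 2F 2F = diagonal 2F
    table 2F 3F = cd
    table 2F 4F = ce
    table 3F 0F = transpose ad
    table 3F 1F = transpose bd
    table 3F 2F = transpose cd
    table 3F 3F = diagonal 3F
    table 3F 4F = de
    table 4F 0F = transpose ae
    table 4F 1F = transpose be
    table 4F 2F = transpose ce
    table 4F 3F = transpose de
    table 4F 4F = diagonal 4F

  module _ (H : Subset n) where

    Dominated : Fin n → Fin n → Set
    Dominated x y = x ∈ H × y ∈ H × x ≢ y × x ≁ y × NbhdIncl G H x y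

    PrivateNeighbours : Set
    PrivateNeighbours = ∀ {u v} → u ∈ H → v ∈ H → u ≢ v → u ≁ v → ∃ λ w → w ∈ H × u ~ w × v ≁ w

    Simplicial : Fin n → Set
    Simplicial x = ∀ {a b} → a ∈ H → b ∈ H → a ≢ b → x ~ a → x ~ b → a ~ b

    NonadjacentNeighbours : Fin n → Set
    NonadjacentNeighbours x = ∃₂ λ a b → a ∈ H × b ∈ H × a ≢ b × x ~ a × x ~ b × a ≁ b

    Confined : Fin n → Fin n → Set
    Confined x y = ∀ {c z} → c ∈ H → z ∈ H → z ≢ x → x ~ c → y ≁ c → c ~ z → x ~ z

    Escape : Fin n → Fin n → Set
    Escape x y = ∃₂ λ c z → c ∈ H × z ∈ H × z ≢ x × x ~ c × y ≁ c × c ~ z × x ≁ z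

    complete? : Complete G H ⊎ ∃₂ λ u v → u ∈ H × v ∈ H × u ≢ v × u ≁ v
    complete? with search₂ (λ u v → u ∈? H ×-dec v ∈? H ×-dec ¬? (u Fin.≟ v) ×-dec adj u v Bool.≟ false)
    ... | inj₁ pair = inj₂ pair
    ... | inj₂ none = inj₁ λ u v u∈H v∈H u≢v → ¬≁⇒~ λ uv → none u v (u∈H , v∈H , u≢v , uv)

    dominated? : (∃₂ Dominated) ⊎ (∀ x y → ¬ Dominated x y)
    dominated? = search₂ λ x y → x ∈? H ×-dec y ∈? H ×-dec ¬? (x Fin.≟ y) ×-dec adj x y Bool.≟ false ×-dec
      Fin.all? λ z → z ∈? H →-dec (adj x z Bool.≟ true →-dec adj y z Bool.≟ true)

    simplicial? : ∀ x → Simplicial x ⊎ NonadjacentNeighbours x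
    simplicial? x with search₂ (λ a b → a ∈? H ×-dec b ∈? H ×-dec ¬? (a Fin.≟ b) ×-dec
                                        adj x a Bool.≟ true ×-dec adj x b Bool.≟ true ×-dec adj a b Bool.≟ false)
    ... | inj₁ pair = inj₂ pair
    ... | inj₂ none = inj₁ λ {a} {b} a∈H b∈H a≢b xa xb → ¬≁⇒~ λ ab → none a b (a∈H , b∈H , a≢b , xa , xb , ab)

    confined? : ∀ x y → Confined x y ⊎ Escape x y
    confined? x y with search₂ (λ c z → c ∈? H ×-dec z ∈? H ×-dec ¬? (z Fin.≟ x) ×-dec adj x c Bool.≟ true ×-dec
                                        adj y c Bool.≟ false ×-dec adj c z Bool.≟ true ×-dec adj x z Bool.≟ false)
    ... | inj₁ escape = inj₂ escape
    ... | inj₂ none = inj₁ λ {c} {z} c∈H z∈H z≢x xc yc cz →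
      ¬≁⇒~ λ xz → none c z (c∈H , z∈H , z≢x , xc , yc , cz , xz)

    privateNeighbours : (∀ x y → ¬ Dominated x y) → PrivateNeighbours
    privateNeighbours none {u} {v} u∈H v∈H u≢v uv
      with Fin.¬∀⟶∃¬ n _ (λ z → z ∈? H →-dec (adj u z Bool.≟ true →-dec adj v z Bool.≟ true))
                        (λ incl → none u v (u∈H , v∈H , u≢v , uv , incl))
    ... | z , ¬incl with z ∈? H | ~-or-≁ u z | ~-or-≁ v z
    ... | no z∉H  | _       | _       = ⊥-elim (¬incl λ z∈H → ⊥-elim (z∉H z∈H))
    ... | yes _   | inj₂ uz | _       = ⊥-elim (¬incl λ _ uz′ → ⊥-elim (≁⇒¬~ uz uz′))
    ... | yes _   | inj₁ _  | inj₁ vz = ⊥-elim (¬incl λ _ _ → vz)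
    ... | yes z∈H | inj₁ uz | inj₂ vz = z , z∈H , uz , vz

    inclusion⇒Confined : ∀ {x y} → NbhdIncl G H x y → Confined x y
    inclusion⇒Confined incl c∈H _ _ xc yc _ = ⊥-elim (≁⇒¬~ yc (incl _ c∈H xc))

    Confined⇒TwoPair : ∀ {x y} → x ∈ H → y ∈ H → x ≢ y → x ≁ y → Confined x y → TwoPair G H x y
    Confined⇒TwoPair {x} {y} x∈H y∈H x≢y xy confined = x∈H , y∈H , x≢y , ≁⇒¬~ xy , length≡2
      where
      length≡2 : ∀ m → ChordlessPath G H x y m → m ≡ 2
      length≡2 0 (_ , _ , p₀ , pₘ) = ⊥-elim (x≢y (trans (sym p₀) pₘ))
      length≡2 1 (p , (_ , _ , path) , refl , refl) = ⊥-elim (≁⇒¬~ xy (Equivalence.from (path 0F 1F) (inj₁ refl)))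
      length≡2 2 _ = refl
      length≡2 (suc (suc (suc m))) (p , (p∈H , p-injective , path) , refl , refl) =
        ⊥-elim (chord₁ₘ (Equivalence.to (path 1F _) (~-sym y~p₁)))
        where
        edge : ∀ {i j} → PathAdj _ i j → p i ~ p j
        edge {i} {j} = Equivalence.from (path i j)
        chord₀₂ : ¬ PathAdj (suc (suc (suc (suc m)))) 0F 2F
        chord₀₂ (inj₁ ())
        chord₀₂ (inj₂ ())
        chord₁ₘ : ¬ PathAdj (suc (suc (suc (suc m)))) 1F (fromℕ (suc (suc (suc m))))
        chord₁ₘ (inj₁ ())
        chord₁ₘ (inj₂ ())
        -- otherwise confinement would give the chord p₀p₂
        y~p₁ : p (fromℕ (suc (suc (suc m)))) ~ p 1F
        y~p₁ = ¬≁⇒~ λ yp₁ → chord₀₂ (Equivalence.to (path 0F 2F)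
          (confined (p∈H 1F) (p∈H 2F) (λ p₂≡p₀ → case p-injective p₂≡p₀ of λ ())
                    (edge (inj₁ refl)) yp₁ (edge (inj₁ refl))))

    Reach-target : ∀ {Q a z} → Reach G H Q a z → Q z
    Reach-target (here q) = q
    Reach-target (step _ q _) = q

    Confined⇒component⊆N[x] : ∀ {x y z} → Confined x y → InCx G H x y z ⊎ InS G H x y z → z ≡ x ⊎ x ~ z
    Confined⇒component⊆N[x] confined (inj₂ (_ , xz , _)) = inj₂ xz
    Confined⇒component⊆N[x] {x} {y} confined (inj₁ reach) = along reach
      where
      along : ∀ {z} → Reach G H (InHminusS G H x y) x z → z ≡ x ⊎ x ~ z
      along (here _) = inj₁ refl
      along {w} (step {u} r (w∈H , _) uw) with along r | w Fin.≟ x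
      ... | inj₁ refl | _       = inj₂ uw
      ... | inj₂ _    | yes w≡x = inj₁ w≡x
      ... | inj₂ xu   | no w≢x  = inj₂ (confined u∈H w∈H w≢x xu yu uw)
        where
        u∈H : u ∈ H
        u∈H = proj₁ (Reach-target r)
        yu : y ≁ u
        yu = ¬~⇒≁ λ yu → proj₂ (Reach-target r) (u∈H , xu , yu)

  module _ (colouring : ThreeColourable G) (freeness : P5-coP5-C5-free G) where

    K4-free : (f : Fin 4 → Fin n) → ¬ (∀ i j → i ≢ j → f i ~ f j)
    K4-free f clique with Fin.pigeonhole (ℕ.n<1+n 3) (λ i → proj₁ colouring (f i))
    ... | i , j , i<j , same = proj₂ colouring (f i) (f j) (clique i j (Fin.<⇒≢ i<j)) same

    noK4 : ∀ {a b c d} → a ~ b → a ~ c → a ~ d → b ~ c → b ~ d → c ~ d → ⊥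
    noK4 {a} {b} {c} {d} ab ac ad bc bd cd = K4-free (lookup (a ∷ b ∷ c ∷ d ∷ [])) clique
      where
      clique : ∀ i j → i ≢ j → lookup (a ∷ b ∷ c ∷ d ∷ []) i ~ lookup (a ∷ b ∷ c ∷ d ∷ []) j
      clique 0F 1F _ = ab
      clique 0F 2F _ = ac
      clique 0F 3F _ = ad
      clique 1F 0F _ = ~-sym ab
      clique 1F 2F _ = bc
      clique 1F 3F _ = bd
      clique 2F 0F _ = ~-sym ac
      clique 2F 1F _ = ~-sym bc
      clique 2F 3F _ = cd
      clique 3F 0F _ = ~-sym ad
      clique 3F 1F _ = ~-sym bd
      clique 3F 2F _ = ~-sym cd
      clique 0F 0F 0≢0 with () ← 0≢0 refl
      clique 1F 1F 1≢1 with () ← 1≢1 refl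
      clique 2F 2F 2≢2 with () ← 2≢2 refl
      clique 3F 3F 3≢3 with () ← 3≢3 refl

    noFivePath : ∀ {a b c d e} → a ~ b → b ~ c → c ~ d → d ~ e → a ≁ c → a ≁ d → b ≁ d → b ≁ e → c ≁ e → ⊥
    noFivePath {a} {e = e} ab bc cd de ac ad bd be ce with ~-or-≁ a e
    ... | inj₁ ae = proj₂ (proj₂ freeness) (induced-from-table C5-pattern _ (table₅ C5-pattern ab ac ad ae bc bd be cd ce de))
    ... | inj₂ ae = proj₁ freeness (induced-from-table P5-pattern _ (table₅ P5-pattern ab ac ad ae bc bd be cd ce de))

    -- the complement of P5 is the house: the square a-b-c-d with the roof r on its side ab
    noHouse : ∀ {a b c d r} → a ~ b → b ~ c → c ~ d → d ~ a → a ≁ c → b ≁ d → r ~ a → r ~ b → r ≁ c → r ≁ d → ⊥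
    noHouse ab bc cd da ac bd ra rb rc rd = proj₁ (proj₂ freeness) (induced-from-table coP5-pattern _
      (table₅ coP5-pattern ac (~-sym ra) (~-sym da) ab (≁-sym rc) cd (~-sym bc) rd rb (≁-sym bd)))

    simplicial-confined⇒SmallCliqueCond : ∀ {H x y} → Simplicial H x → Confined H x y → SmallCliqueCond G H x y
    simplicial-confined⇒SmallCliqueCond {H} {x} {y} simplicial confined = clique , λ f members injective →
      K4-free f λ i j i≢j → clique _ _ (members i) (members j) λ fi≡fj → i≢j (injective fi≡fj)
      where
      T : Fin n → Set
      T z = InCx G H x y z ⊎ InS G H x y z
      T⊆H : ∀ {z} → T z → z ∈ H
      T⊆H (inj₁ reach) = proj₁ (Reach-target H reach)
      T⊆H (inj₂ (z∈H , _)) = z∈H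
      clique : ∀ u v → T u → T v → u ≢ v → u ~ v
      clique u v Tu Tv u≢v with Confined⇒component⊆N[x] H confined Tu | Confined⇒component⊆N[x] H confined Tv
      ... | inj₁ refl | inj₁ refl = ⊥-elim (u≢v refl)
      ... | inj₁ refl | inj₂ xv   = xv
      ... | inj₂ xu   | inj₁ refl = ~-sym xu
      ... | inj₂ xu   | inj₂ xv   = simplicial (T⊆H Tu) (T⊆H Tv) u≢v xu xv

    condition-iii : ∀ {H x y} → x ∈ H → y ∈ H → x ≢ y → x ≁ y → Simplicial H x → Confined H x y →
                    TwoPair G H x y × SmallCliqueCond G H x y
    condition-iii x∈H y∈H x≢y xy simplicial confined =
      Confined⇒TwoPair _ x∈H y∈H x≢y xy confined , simplicial-confined⇒SmallCliqueCond simplicial confined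

    module WithoutDominatedPairs {H : Subset n} (private-neighbour : PrivateNeighbours H) where

      noDiamond : ∀ {h₁ h₂ t₁ t₂} → h₁ ∈ H → h₂ ∈ H → t₁ ∈ H → t₂ ∈ H → t₁ ≢ t₂ →
                  h₁ ~ h₂ → h₁ ~ t₁ → h₁ ~ t₂ → h₂ ~ t₁ → h₂ ~ t₂ → t₁ ≁ t₂ → ⊥
      noDiamond {h₁} {h₂} {t₁} {t₂} h₁∈H h₂∈H t₁∈H t₂∈H t₁≢t₂ h₁h₂ h₁t₁ h₁t₂ h₂t₁ h₂t₂ t₁t₂
        with private-neighbour t₁∈H t₂∈H t₁≢t₂ t₁t₂ | private-neighbour t₂∈H t₁∈H (≢-sym t₁≢t₂) (≁-sym t₁t₂)
      ... | w , w∈H , t₁w , t₂w | w′ , _ , t₂w′ , t₁w′ =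
        cases (missesAHead h₁t₁ h₂t₁ t₁w) (missesAHead h₁t₂ h₂t₂ t₂w′)
        where
        missesAHead : ∀ {t v} → h₁ ~ t → h₂ ~ t → t ~ v → h₁ ≁ v ⊎ h₂ ≁ v
        missesAHead {v = v} h₁t h₂t tv with ~-or-≁ h₁ v | ~-or-≁ h₂ v
        ... | inj₂ h₁v | _        = inj₁ h₁v
        ... | inj₁ _   | inj₂ h₂v = inj₂ h₂v
        ... | inj₁ h₁v | inj₁ h₂v = ⊥-elim (noK4 h₁h₂ h₁t h₁v h₂t h₂v tv)

        missedByBoth : ∀ {h} → h ~ t₁ → h ~ t₂ → h ≁ w → h ≁ w′ → ⊥
        missedByBoth ht₁ ht₂ hw hw′ =
          noFivePath (~-sym t₁w) (~-sym ht₁) ht₂ t₂w′ (≁-sym hw) (≁-sym t₂w) t₁t₂ t₁w′ hw′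

        crossed : ∀ {h h′} → h ∈ H → h ~ h′ → h ~ t₁ → h ~ t₂ → h′ ~ t₁ →
                  h′ ~ w → h ≁ w → h ~ w′ → h′ ≁ w′ → ⊥
        crossed {h′ = h′} h∈H hh′ ht₁ ht₂ h′t₁ h′w hw hw′ h′w′ with ~-or-≁ w w′
        ... | inj₁ ww′ = noHouse hw′ (~-sym ww′) (~-sym t₁w) (~-sym ht₁) hw (≁-sym t₁w′)
                                 (~-sym ht₂) t₂w′ t₂w (≁-sym t₁t₂)
        ... | inj₂ ww′ with private-neighbour w∈H h∈H (≢-sym (separated⇒≢ ht₂ (≁-sym t₂w))) (≁-sym hw)
        ...   | w″ , _ , ww″ , hw″ with ~-or-≁ t₁ w″ | ~-or-≁ h′ w″
        ...     | inj₂ t₁w″ | _         = noFivePath (~-sym ht₂) ht₁ t₁w ww″ (≁-sym t₁t₂) t₂w hw hw″ t₁w″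
        ...     | inj₁ t₁w″ | inj₁ h′w″ = noK4 h′t₁ h′w h′w″ t₁w t₁w″ ww″
        ...     | inj₁ _    | inj₂ h′w″ = noFivePath (~-sym ww″) (~-sym h′w) (~-sym hh′) hw′
                                            (≁-sym h′w″) (≁-sym hw″) (≁-sym hw) ww′ h′w′

        crossedOrMissed : ∀ {h h′} → h ∈ H → h ~ h′ → h ~ t₁ → h ~ t₂ → h′ ~ t₁ → h′ ~ t₂ → h ≁ w → h′ ≁ w′ → ⊥
        crossedOrMissed {h} {h′} h∈H hh′ ht₁ ht₂ h′t₁ h′t₂ hw h′w′ with ~-or-≁ h′ w | ~-or-≁ h w′
        ... | inj₂ h′w | _        = missedByBoth h′t₁ h′t₂ h′w h′w′
        ... | inj₁ _   | inj₂ hw′ = missedByBoth ht₁ ht₂ hw hw′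
        ... | inj₁ h′w | inj₁ hw′ = crossed h∈H hh′ ht₁ ht₂ h′t₁ h′w hw hw′ h′w′

        cases : h₁ ≁ w ⊎ h₂ ≁ w → h₁ ≁ w′ ⊎ h₂ ≁ w′ → ⊥
        cases (inj₁ h₁w) (inj₁ h₁w′) = missedByBoth h₁t₁ h₁t₂ h₁w h₁w′
        cases (inj₂ h₂w) (inj₂ h₂w′) = missedByBoth h₂t₁ h₂t₂ h₂w h₂w′
        cases (inj₁ h₁w) (inj₂ h₂w′) = crossedOrMissed h₁∈H h₁h₂ h₁t₁ h₁t₂ h₂t₁ h₂t₂ h₁w h₂w′
        cases (inj₂ h₂w) (inj₁ h₁w′) = crossedOrMissed h₂∈H (~-sym h₁h₂) h₂t₁ h₂t₂ h₁t₁ h₁t₂ h₂w h₁w′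

      cornerNeighbour : ∀ {p q r s x} → p ∈ H → q ∈ H → s ∈ H → x ∈ H → q ≢ s →
        p ~ q → q ~ r → r ~ s → s ~ p → p ≁ r → q ≁ s → p ~ x → r ≁ x → q ≁ x × s ≁ x
      cornerNeighbour {q = q} {s = s} {x = x} p∈H q∈H s∈H x∈H q≢s pq qr rs sp pr qs px rx
        with ~-or-≁ q x | ~-or-≁ s x
      ... | inj₁ qx | inj₁ sx = ⊥-elim (noDiamond p∈H x∈H q∈H s∈H q≢s px pq (~-sym sp) (~-sym qx) (~-sym sx) qs)
      ... | inj₁ qx | inj₂ sx = ⊥-elim (noHouse pq qr rs sp pr qs (~-sym px) (~-sym qx) (≁-sym rx) (≁-sym sx))
      ... | inj₂ qx | inj₁ sx = ⊥-elim (noHouse (~-sym sp) (~-sym rs) (~-sym qr) (~-sym pq) pr (≁-sym qs)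
                                          (~-sym px) (~-sym sx) (≁-sym rx) (≁-sym qx))
      ... | inj₂ qx | inj₂ sx = qx , sx

      noC4 : ∀ {a b c d} → a ∈ H → b ∈ H → c ∈ H → d ∈ H → a ≢ c → b ≢ d →
             a ~ b → b ~ c → c ~ d → d ~ a → a ≁ c → b ≁ d → ⊥
      noC4 a∈H b∈H c∈H d∈H a≢c b≢d ab bc cd da ac bd
        with private-neighbour a∈H c∈H a≢c ac | private-neighbour c∈H a∈H (≢-sym a≢c) (≁-sym ac)
      ... | w , w∈H , aw , cw | w′ , w′∈H , cw′ , aw′
        with cornerNeighbour a∈H b∈H d∈H w∈H b≢d ab bc cd da ac bd aw cw
           | cornerNeighbour c∈H b∈H d∈H w′∈H b≢d (~-sym bc) (~-sym ab) (~-sym da) (~-sym cd) (≁-sym ac) bd cw′ aw′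
      ... | bw , _ | bw′ , _ = noFivePath (~-sym aw) ab bc cw′ (≁-sym bw) (≁-sym cw) ac aw′ bw′

      noTwoCommonNeighbours : ∀ {u v a b} → u ∈ H → v ∈ H → a ∈ H → b ∈ H → u ≢ v → a ≢ b →
                              u ≁ v → u ~ a → v ~ a → u ~ b → v ~ b → ⊥
      noTwoCommonNeighbours {a = a} {b} u∈H v∈H a∈H b∈H u≢v a≢b uv ua va ub vb with ~-or-≁ a b
      ... | inj₁ ab = noDiamond a∈H b∈H u∈H v∈H u≢v ab (~-sym ua) (~-sym va) (~-sym ub) (~-sym vb) uv
      ... | inj₂ ab = noC4 u∈H a∈H v∈H b∈H u≢v a≢b ua (~-sym va) vb (~-sym ub) uv ab

      P4-end : ∀ {a b c d e} → b ∈ H → c ∈ H → d ∈ H → e ∈ H → e ≢ c →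
               a ~ b → b ~ c → c ~ d → a ≁ c → a ≁ d → b ≁ d → d ~ e → c ~ e
      P4-end {b = b} {c} {e = e} b∈H c∈H d∈H e∈H e≢c ab bc cd ac ad bd de with ~-or-≁ c e | ~-or-≁ b e
      ... | inj₁ ce | _       = ce
      ... | inj₂ ce | inj₁ be = ⊥-elim (noTwoCommonNeighbours b∈H d∈H c∈H e∈H (separated⇒≢ (~-sym ab) (≁-sym ad))
                                           (≢-sym e≢c) bd bc (~-sym cd) be de)
      ... | inj₂ ce | inj₂ be = ⊥-elim (noFivePath ab bc cd de ac ad bd be ce)

      neighbourAvoiding : ∀ {x s} → x ∈ H → s ∈ H → x ~ s → NonadjacentNeighbours H x →
                     ∃ λ a → a ∈ H × a ≢ s × x ~ a × s ≁ a
      neighbourAvoiding {s = s} x∈H s∈H xs (p , q , p∈H , q∈H , p≢q , xp , xq , pq) with ~-or-≁ s p | ~-or-≁ s q | p Fin.≟ s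
      ... | inj₂ sp | _       | no p≢s = p , p∈H , p≢s , xp , sp
      ... | inj₂ _  | _       | yes refl = q , q∈H , ≢-sym p≢q , xq , pq
      ... | inj₁ sp | inj₂ sq | _      = q , q∈H , ≢-sym (separated⇒≢ sp (≁-sym pq)) , xq , sq
      ... | inj₁ sp | inj₁ sq | _      = ⊥-elim (noTwoCommonNeighbours p∈H q∈H x∈H s∈H p≢q (~⇒≢ xs) pq
                                            (~-sym xp) (~-sym xq) (~-sym sp) (~-sym sq))

      opposite-of-nonsimplicial : ∀ {x y s} → x ∈ H → y ∈ H → s ∈ H → x ≢ y → x ≁ y → x ~ s → y ~ s →
                                  NonadjacentNeighbours H x → Simplicial H y × Confined H y x
      opposite-of-nonsimplicial {x} {y} {s} x∈H y∈H s∈H x≢y xy xs ys nonsimplicial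
        with neighbourAvoiding x∈H s∈H xs nonsimplicial
      ... | a , a∈H , a≢s , xa , sa = simplicial , confined
        where
        ay : a ≁ y
        ay = ¬~⇒≁ λ ay → noTwoCommonNeighbours x∈H y∈H s∈H a∈H x≢y (≢-sym a≢s) xy xs ys xa (~-sym ay)

        -- a-x-s-y is an induced path
        y-end : ∀ {e} → e ∈ H → e ≢ s → y ~ e → s ~ e
        y-end e∈H e≢s = P4-end x∈H s∈H y∈H e∈H e≢s (~-sym xa) xs (~-sym ys) (≁-sym sa) ay xy

        simplicial : Simplicial H y
        simplicial {r} {t} r∈H t∈H r≢t yr yt with r Fin.≟ s | t Fin.≟ s
        ... | yes refl | _        = y-end t∈H (≢-sym r≢t) yt
        ... | no _     | yes refl = ~-sym (y-end r∈H r≢t yr)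
        ... | no r≢s   | no t≢s   = ¬≁⇒~ λ rt → noTwoCommonNeighbours r∈H t∈H y∈H s∈H r≢t (~⇒≢ ys) rt
                                      (~-sym yr) (~-sym yt) (~-sym (y-end r∈H r≢s yr)) (~-sym (y-end t∈H t≢s yt))

        confined : Confined H y x
        confined {c} {z} c∈H z∈H z≢y yc xc cz with z Fin.≟ s
        ... | yes refl = ys
        ... | no z≢s = ¬≁⇒~ λ yz → noTwoCommonNeighbours y∈H z∈H s∈H c∈H (≢-sym z≢y) s≢c yz ys (~-sym sz) yc (~-sym cz)
          where
          s≢c : s ≢ c
          s≢c = separated⇒≢ (~-sym xs) (≁-sym xc)
          sc : s ~ c
          sc = y-end c∈H (≢-sym s≢c) yc
          ac : a ≁ c
          ac = ¬~⇒≁ λ ac → noTwoCommonNeighbours a∈H s∈H x∈H c∈H a≢s (≢-sym (separated⇒≢ (~-sym yc) xy))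
                             (≁-sym sa) (~-sym xa) (~-sym xs) ac sc
          -- a-x-s-c is an induced path
          sz : s ~ z
          sz = P4-end x∈H s∈H c∈H z∈H z≢s (~-sym xa) xs sc (≁-sym sa) ac xc cz

      escape-through : ∀ {x y s c z} → x ∈ H → s ∈ H → c ∈ H → z ∈ H → z ≢ x → x ≁ y → x ~ s → y ~ s →
                       x ~ c → y ≁ c → c ~ z → x ≁ z → s ~ c
      escape-through x∈H s∈H c∈H z∈H z≢x xy xs ys xc yc cz xz =
        ¬≁⇒~ λ sc → ≁⇒¬~ xz (P4-end s∈H x∈H c∈H z∈H z≢x ys (~-sym xs) xc (≁-sym xy) yc sc cz)

      noDoubleEscape : ∀ {x y s} → x ∈ H → y ∈ H → s ∈ H → x ≁ y → x ~ s → y ~ s → Escape H x y → Escape H y x → ⊥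
      noDoubleEscape {s = s} x∈H y∈H s∈H xy xs ys (c , z , c∈H , z∈H , z≢x , xc , yc , cz , xz)
                                          (c′ , z′ , c′∈H , z′∈H , z′≢y , yc′ , xc′ , c′z′ , yz′) =
        noTwoCommonNeighbours y∈H z′∈H c′∈H s∈H (≢-sym z′≢y) (≢-sym s≢c′) yz′ yc′ (~-sym c′z′) ys (~-sym sz′)
        where
        sc : s ~ c
        sc = escape-through x∈H s∈H c∈H z∈H z≢x xy xs ys xc yc cz xz
        sc′ : s ~ c′
        sc′ = escape-through y∈H s∈H c′∈H z′∈H z′≢y (≁-sym xy) ys xs yc′ xc′ c′z′ yz′
        s≢c : s ≢ c
        s≢c = separated⇒≢ (~-sym ys) (≁-sym yc)
        s≢c′ : s ≢ c′
        s≢c′ = separated⇒≢ (~-sym xs) (≁-sym xc′)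
        cc′ : c ≁ c′
        cc′ = ¬~⇒≁ λ cc′ → noTwoCommonNeighbours x∈H c′∈H c∈H s∈H (≢-sym (separated⇒≢ (~-sym yc′) xy)) (≢-sym s≢c)
                             xc′ xc (~-sym cc′) xs (~-sym sc′)
        zs : z ≁ s
        zs = ¬~⇒≁ λ zs → noTwoCommonNeighbours x∈H z∈H c∈H s∈H (≢-sym z≢x) (≢-sym s≢c) xz xc (~-sym cz) xs zs
        zc′ : z ≁ c′
        zc′ = ¬~⇒≁ λ zc′ → noTwoCommonNeighbours c∈H c′∈H s∈H z∈H (≢-sym (separated⇒≢ (~-sym yc′) (≁-sym yc)))
                             (separated⇒≢ (~-sym xs) (≁-sym xz)) cc′ (~-sym sc) (~-sym sc′) cz (~-sym zc′)
        -- z-c-s-c′ is an induced path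
        sz′ : s ~ z′
        sz′ = P4-end c∈H s∈H c′∈H z′∈H (≢-sym (separated⇒≢ (~-sym ys) (≁-sym yz′))) (~-sym cz) (~-sym sc) sc′ zs zc′ cc′ c′z′

      simplicial-confined-end : ∀ {x y s} → x ∈ H → y ∈ H → s ∈ H → x ≢ y → x ≁ y → x ~ s → y ~ s →
        (Simplicial H x × Confined H x y) ⊎ (Simplicial H y × Confined H y x)
      simplicial-confined-end {x} {y} x∈H y∈H s∈H x≢y xy xs ys
        with simplicial? H x | confined? H x y | simplicial? H y | confined? H y x
      ... | inj₂ nx | _       | _       | _       = inj₂ (opposite-of-nonsimplicial x∈H y∈H s∈H x≢y xy xs ys nx)
      ... | inj₁ sx | inj₁ cx | _       | _       = inj₁ (sx , cx)
      ... | inj₁ _  | inj₂ _  | inj₂ ny | _       = inj₁ (opposite-of-nonsimplicial y∈H x∈H s∈H (≢-sym x≢y) (≁-sym xy) ys xs ny)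
      ... | inj₁ _  | inj₂ _  | inj₁ sy | inj₁ cy = inj₂ (sy , cy)
      ... | inj₁ _  | inj₂ ex | inj₁ _  | inj₂ ey = ⊥-elim (noDoubleEscape x∈H y∈H s∈H xy xs ys ex ey)

      SmallCliquePair : Set
      SmallCliquePair = ∃₂ λ x y → TwoPair G H x y × SmallCliqueCond G H x y

      P3⇒SmallCliquePair : ∀ {x y s} → x ∈ H → y ∈ H → s ∈ H → x ≢ y → x ≁ y → x ~ s → y ~ s → SmallCliquePair
      P3⇒SmallCliquePair {x} {y} x∈H y∈H s∈H x≢y xy xs ys with simplicial-confined-end x∈H y∈H s∈H x≢y xy xs ys
      ... | inj₁ (sx , cx) = x , y , condition-iii x∈H y∈H x≢y xy sx cx
      ... | inj₂ (sy , cy) = y , x , condition-iii y∈H x∈H (≢-sym x≢y) (≁-sym xy) sy cy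

      smallCliquePair : ∀ {u v} → u ∈ H → v ∈ H → u ≢ v → u ≁ v → SmallCliquePair
      smallCliquePair {u} {v} u∈H v∈H u≢v uv with simplicial? H u | confined? H u v
      ... | inj₁ su | inj₁ cu = u , v , condition-iii u∈H v∈H u≢v uv su cu
      ... | inj₂ (p , q , p∈H , q∈H , p≢q , up , uq , pq) | _ = P3⇒SmallCliquePair p∈H q∈H u∈H p≢q pq (~-sym up) (~-sym uq)
      ... | inj₁ _ | inj₂ (c , z , c∈H , z∈H , z≢u , uc , _ , cz , uz) = P3⇒SmallCliquePair u∈H z∈H c∈H (≢-sym z≢u) uz uc (~-sym cz)

    everySubgraph : (H : Subset n) → Complete G H
      ⊎ (∃ λ x → ∃ λ y → TwoPair G H x y × NbhdIncl G H x y)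
      ⊎ (∃ λ x → ∃ λ y → TwoPair G H x y × SmallCliqueCond G H x y)
    everySubgraph H with complete? H | dominated? H
    ... | inj₁ complete | _ = inj₁ complete
    ... | inj₂ _ | inj₁ (x , y , x∈H , y∈H , x≢y , xy , incl) =
      inj₂ (inj₁ (x , y , Confined⇒TwoPair H x∈H y∈H x≢y xy (inclusion⇒Confined H incl) , incl))
    ... | inj₂ (u , v , u∈H , v∈H , u≢v , uv) | inj₂ none =
      inj₂ (inj₂ (WithoutDominatedPairs.smallCliquePair (privateNeighbours H none) u∈H v∈H u≢v uv))

lemma3 : ∀ {n : ℕ} (G : Graph n) → ThreeColourable G → P5-coP5-C5-free G → Compact G
lemma3 G colouring freeness = weaklyChordal G freeness , everySubgraph G colouring freeness
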